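{- Let $u,v\ge 1$ be integers and $z$ a positive rational number. For every integer $n\ge 0$ and every $i=1,\dots,2^n-1$, writing $\alpha_i=c_z^{(u,v)}(n,i)$ and $\alpha_{i+1}=c_z^{(u,v)}(n,i+1)$, we have \[ \alpha_{i+1}=\frac{v\{\alpha_i\}+v^2(1-u\{\alpha_i\})}{u[\alpha_i]\big(\{\alpha_i\}+v(1-u\{\alpha_i\})\big)+v(1-u\{\alpha_i\})}, \] where $[x]$ and $\{x\}=x-[x]$ denote the integer part and fractional part of a real number $x$.
   Context: For integers $u,v\ge 1$ and a positive rational $z$, the $(u,v)$-Calkin–Wilf tree $\mathcal{T}^{(u,v)}(z)$ is the infinite binary tree with root $z$ in which every vertex $w$ has left child $w/(uw+1)$ and right child $w+v$. Rows are numbered from $0$ (row $0$ is the root), so row $n$ has $2^n$ vertices; $c_z^{(u,v)}(n,i)$ denotes the $i$-th vertex from the left in row $n$ (the left and right children of the $k$-th vertex of row $n$ are the $(2k-1)$-th and $2k$-th vertices of row $n+1$). -}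

module Defs where

open import Data.Nat as ℕ using (ℕ; zero; suc)
open import Data.Nat.DivMod using (_/_; _%_)
open import Data.Integer as ℤ using (ℤ; ∣_∣)
open import Data.Rational as ℚ using (ℚ; floor; ↥_; _-_)
open import Data.Bool using (if_then_else_)

-- Written on the reduced form w = p/q
-- (q = suc d) as p / (u*|p| + q), which equals w/(u w + 1) for every
-- positive rational w (the only vertices that occur, since z > 0);
-- this form avoids a nonzero-denominator side condition.
leftChild : ℕ → ℚ → ℚ
leftChild u w = ↥ w ℚ./ suc (u ℕ.* ∣ ↥ w ∣ ℕ.+ ℚ.ℚ.denominator-1 w)

rightChild : ℕ → ℚ → ℚ
rightChild v w = w ℚ.+ (ℤ.+ v ℚ./ 1)

-- vertex0 u v z n j : the vertex of row n with 0-based position j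
-- (counted from the left).  Position j of row n+1 is the left child
-- (j even) or right child (j odd) of position ⌊j/2⌋ of row n.
vertex0 : ℕ → ℕ → ℚ → ℕ → ℕ → ℚ
vertex0 u v z zero    j = z
vertex0 u v z (suc n) j =
  if j % 2 ℕ.≡ᵇ 0
  then leftChild u (vertex0 u v z n (j / 2))
  else rightChild v (vertex0 u v z n (j / 2))

c : ℕ → ℕ → ℚ → ℕ → ℕ → ℚ
c u v z n i = vertex0 u v z n (i ℕ.∸ 1)

intPart : ℚ → ℚ
intPart x = floor x ℚ./ 1

fracPart : ℚ → ℚ
fracPart x = x - intPart x

-- Two adjacent vertices of a row are reached from their lowest common ancestor w
-- as α = Rᵏ(L w) and α′ = Lᵏ(R w), where L w = w/(uw+1) and R w = w+v.
-- Since 0 < L w < 1 (this uses u ≥ 1) and Rᵏ adds kv, we get [α] = kv and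
-- {α} = w/(uw+1), while Lᵏ y = y/(uky+1) gives α′ = (w+v)/(uk(w+v)+1).
-- Eliminating w = {α}/(1 - u{α}) and k = [α]/v yields the stated formula.
module Submission where

open import Defs
open import Data.Nat as ℕ using (ℕ; _≤_; _<_; _^_)
open import Data.Integer as ℤ using ()
open import Data.Rational as ℚ using (ℚ; Positive; NonZero; _+_; _-_; _*_; _÷_; 1ℚ)
open import Data.Product using (Σ)
open import Relation.Binary.PropositionalEquality using (_≡_)

open import Data.Nat using (zero; suc)
import Data.Nat.Properties as ℕ
import Data.Nat.DivMod as ℕ
import Data.Nat.Coprimality as Coprimality
open import Data.Nat.Divisibility using (divides-refl)
open import Data.Nat.GeneralisedArithmetic using (fold)
open import Data.Integer using (+_; +[1+_]; -[1+_])
import Data.Integer.Properties as ℤ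
open import Data.Integer.DivMod using (div-pos-is-/ℕ)
open import Data.Rational using (mkℚ; floor; NonNegative; 0ℚ; 1/_; toℚᵘ; ↥_; ↧ₙ_)
import Data.Rational.Properties as ℚ
open import Data.Rational.Unnormalised as ℚᵘ using (mkℚᵘ; *≡*)
import Data.Rational.Unnormalised.Properties as ℚᵘ
open import Data.Rational.Solver using (module +-*-Solver)
open import Data.Product using (_,_; _×_; ∃-syntax)
open import Relation.Binary.PropositionalEquality
  using (refl; sym; trans; cong; cong₂; subst; subst₂; module ≡-Reasoning)

open +-*-Solver using (solve; _:=_; _:+_; _:*_; _:-_; con)

toℚ : ℕ → ℚ
toℚ n = + n ℚ./ 1

toℚ-mkℚ : ∀ n → toℚ n ≡ mkℚ (+ n) 0 (Coprimality.sym (Coprimality.1-coprimeTo n))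
toℚ-mkℚ n = ℚ.normalize-coprime _

toℚᵘ-toℚ : ∀ n → toℚᵘ (toℚ n) ℚᵘ.≃ mkℚᵘ (+ n) 0
toℚᵘ-toℚ n = ℚ.toℚᵘ-fromℚᵘ (mkℚᵘ (+ n) 0)

toℚ-nonNeg : ∀ n → NonNegative (toℚ n)
toℚ-nonNeg n = ℚ.normalize-nonNeg n 1

toℚ-pos : ∀ n .{{_ : ℕ.NonZero n}} → Positive (toℚ n)
toℚ-pos n = ℚ.normalize-pos n 1

toℚ-+ : ∀ m n → toℚ (m ℕ.+ n) ≡ toℚ m + toℚ n
toℚ-+ m n = ℚ.toℚᵘ-injective (begin
  toℚᵘ (toℚ (m ℕ.+ n))           ≈⟨ toℚᵘ-toℚ (m ℕ.+ n) ⟩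
  mkℚᵘ (+ (m ℕ.+ n)) 0            ≈⟨ *≡* (cong (ℤ._* + 1) (sym
                                       (cong₂ ℤ._+_ (ℤ.*-identityʳ (+ m)) (ℤ.*-identityʳ (+ n))))) ⟩
  mkℚᵘ (+ m) 0 ℚᵘ.+ mkℚᵘ (+ n) 0  ≈⟨ ℚᵘ.+-cong (toℚᵘ-toℚ m) (toℚᵘ-toℚ n) ⟨
  toℚᵘ (toℚ m) ℚᵘ.+ toℚᵘ (toℚ n)  ≈⟨ ℚ.toℚᵘ-homo-+ (toℚ m) (toℚ n) ⟨
  toℚᵘ (toℚ m + toℚ n)            ∎)
  where open ℚᵘ.≃-Reasoning

toℚ-* : ∀ m n → toℚ (m ℕ.* n) ≡ toℚ m * toℚ n
toℚ-* m n = ℚ.toℚᵘ-injective (begin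
  toℚᵘ (toℚ (m ℕ.* n))           ≈⟨ toℚᵘ-toℚ (m ℕ.* n) ⟩
  mkℚᵘ (+ (m ℕ.* n)) 0            ≈⟨ *≡* (cong (ℤ._* + 1) (ℤ.pos-* m n)) ⟩
  mkℚᵘ (+ m) 0 ℚᵘ.* mkℚᵘ (+ n) 0  ≈⟨ ℚᵘ.*-cong (toℚᵘ-toℚ m) (toℚᵘ-toℚ n) ⟨
  toℚᵘ (toℚ m) ℚᵘ.* toℚᵘ (toℚ n)  ≈⟨ ℚ.toℚᵘ-homo-* (toℚ m) (toℚ n) ⟨
  toℚᵘ (toℚ m * toℚ n)            ∎)
  where open ℚᵘ.≃-Reasoning

m/n*n≡m : ∀ m n .{{_ : ℕ.NonZero n}} → (+ m ℚ./ n) * toℚ n ≡ toℚ m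
m/n*n≡m m n@(suc n-1) = ℚ.toℚᵘ-injective (begin
  toℚᵘ ((+ m ℚ./ n) * toℚ n)          ≈⟨ ℚ.toℚᵘ-homo-* (+ m ℚ./ n) (toℚ n) ⟩
  toℚᵘ (+ m ℚ./ n) ℚᵘ.* toℚᵘ (toℚ n)  ≈⟨ ℚᵘ.*-cong (ℚ.toℚᵘ-fromℚᵘ (mkℚᵘ (+ m) n-1)) (toℚᵘ-toℚ n) ⟩
  mkℚᵘ (+ m) n-1 ℚᵘ.* mkℚᵘ (+ n) 0    ≈⟨ *≡* (trans (ℤ.*-identityʳ _)
                                           (cong (λ k → + m ℤ.* + k) (sym (ℕ.*-identityʳ n)))) ⟩
  mkℚᵘ (+ m) 0                        ≈⟨ toℚᵘ-toℚ m ⟨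
  toℚᵘ (toℚ m)                        ∎)
  where open ℚᵘ.≃-Reasoning

m<n⇒m/n<1 : ∀ {m n} .{{_ : ℕ.NonZero n}} → m < n → + m ℚ./ n ℚ.< 1ℚ
m<n⇒m/n<1 {m} {n@(suc n-1)} m<n = ℚ.toℚᵘ-cancel-<
  (ℚᵘ.<-respˡ-≃ (ℚᵘ.≃-sym (ℚ.toℚᵘ-fromℚᵘ (mkℚᵘ (+ m) n-1)))
    (ℚᵘ.*<* (subst₂ ℤ._<_ (sym (ℤ.*-identityʳ (+ m))) (sym (ℤ.*-identityˡ (+ n))) (ℤ.+<+ m<n))))

*≡⇒≡÷ : ∀ {x y} d .{{_ : NonZero d}} → x * d ≡ y → x ≡ y ÷ d
*≡⇒≡÷ {x} {y} d x*d≡y = begin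
  x               ≡⟨ ℚ.*-identityʳ x ⟨
  x * 1ℚ          ≡⟨ cong (x *_) (ℚ.*-inverseʳ d) ⟨
  x * (d * 1/ d)  ≡⟨ ℚ.*-assoc x d (1/ d) ⟨
  x * d * 1/ d    ≡⟨ cong (_* 1/ d) x*d≡y ⟩
  y * 1/ d        ∎
  where open ≡-Reasoning

*-cancelʳ-≡ : ∀ {x y} d .{{_ : NonZero d}} → x * d ≡ y * d → x ≡ y
*-cancelʳ-≡ d x*d≡y*d = trans (*≡⇒≡÷ d x*d≡y*d) (sym (*≡⇒≡÷ d refl))

m*n≤o<[1+m]*n⇒o/n≡m : ∀ {m n o} .{{_ : ℕ.NonZero n}} →
                      m ℕ.* n ≤ o → o < suc m ℕ.* n → o ℕ./ n ≡ m
m*n≤o<[1+m]*n⇒o/n≡m {m} {n} lo hi = ℕ.≤-antisym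
  (ℕ.s≤s⁻¹ (ℕ.m<n*o⇒m/o<n hi))
  (subst (_≤ _) (ℕ.m*n/n≡m m n) (ℕ./-monoˡ-≤ n lo))

toℚ≤⇒ : ∀ {m x} → toℚ m ℚ.≤ x → + (m ℕ.* ↧ₙ x) ℤ.≤ ↥ x
toℚ≤⇒ {m} {x} m≤x = subst₂ ℤ._≤_ (sym (ℤ.pos-* m (↧ₙ x))) (ℤ.*-identityʳ (↥ x))
  (ℚ.drop-*≤* (subst (ℚ._≤ _) (toℚ-mkℚ m) m≤x))

<toℚ⇒ : ∀ {m x} → x ℚ.< toℚ m → ↥ x ℤ.< + (m ℕ.* ↧ₙ x)
<toℚ⇒ {m} {x} x<m = subst₂ ℤ._<_ (ℤ.*-identityʳ (↥ x)) (sym (ℤ.pos-* m (↧ₙ x)))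
  (ℚ.drop-*<* (subst (_ ℚ.<_) (toℚ-mkℚ m) x<m))

floor-unique : ∀ {x} m → toℚ m ℚ.≤ x → x ℚ.< toℚ (suc m) → floor x ≡ + m
floor-unique {mkℚ (+ a) d _} m m≤x x<m+1 = trans (div-pos-is-/ℕ (+ a) (suc d))
  (cong +_ (m*n≤o<[1+m]*n⇒o/n≡m (ℤ.drop‿+≤+ (toℚ≤⇒ {m} m≤x)) (ℤ.drop‿+<+ (<toℚ⇒ {suc m} x<m+1))))
floor-unique {mkℚ -[1+ a ] d _} m m≤x _ with toℚ≤⇒ {m} m≤x
... | ()

intPart-+toℚ : ∀ {t} m → 0ℚ ℚ.≤ t → t ℚ.< 1ℚ → intPart (t + toℚ m) ≡ toℚ m
intPart-+toℚ {t} m 0≤t t<1 = cong (ℚ._/ 1) (floor-unique m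
  (subst (ℚ._≤ t + toℚ m) (ℚ.+-identityˡ (toℚ m)) (ℚ.+-monoˡ-≤ (toℚ m) 0≤t))
  (subst (t + toℚ m ℚ.<_) (sym (toℚ-+ 1 m)) (ℚ.+-monoˡ-< (toℚ m) t<1)))

fracPart-+toℚ : ∀ {t} m → 0ℚ ℚ.≤ t → t ℚ.< 1ℚ → fracPart (t + toℚ m) ≡ t
fracPart-+toℚ {t} m 0≤t t<1 = begin
  t + toℚ m - intPart (t + toℚ m)  ≡⟨ cong (t + toℚ m -_) (intPart-+toℚ m 0≤t t<1) ⟩
  t + toℚ m - toℚ m                ≡⟨ solve 2 (λ t M → t :+ M :- M := t) refl t (toℚ m) ⟩
  t                                ∎
  where open ≡-Reasoning

leftChild-pos : ∀ u w .{{_ : Positive w}} → Positive (leftChild u w)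
leftChild-pos u (mkℚ +[1+ a ] d _) = ℚ.normalize-pos (suc a) (suc (u ℕ.* suc a ℕ.+ d))

leftChild<1 : ∀ u w .{{_ : ℕ.NonZero u}} .{{_ : Positive w}} → leftChild u w ℚ.< 1ℚ
leftChild<1 u (mkℚ +[1+ a ] d _) =
  m<n⇒m/n<1 (ℕ.s≤s (ℕ.≤-trans (ℕ.m≤n*m (suc a) u) (ℕ.m≤m+n _ d)))

leftChild-spec : ∀ u w .{{_ : Positive w}} → leftChild u w * (toℚ u * w + 1ℚ) ≡ w
leftChild-spec u w@(mkℚ +[1+ a ] d _) = *-cancelʳ-≡ Q {{ℚ.pos⇒nonZero Q {{toℚ-pos (suc d)}}}} (begin
  t * (U * w + 1ℚ) * Q   ≡⟨ solve 4 (λ t U w Q → t :* (U :* w :+ con 1ℚ) :* Q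
                                              := t :* (U :* (w :* Q) :+ Q)) refl t U w Q ⟩
  t * (U * (w * Q) + Q)  ≡⟨ cong (λ x → t * (U * x + Q)) w*Q≡P ⟩
  t * (U * P + Q)        ≡⟨ cong (t *_) denominator ⟨
  t * toℚ E              ≡⟨ m/n*n≡m (suc a) E ⟩
  P                      ≡⟨ w*Q≡P ⟨
  w * Q                  ∎)
  where
  open ≡-Reasoning
  t = leftChild u w
  U = toℚ u
  P = toℚ (suc a)
  Q = toℚ (suc d)
  E = suc (u ℕ.* suc a ℕ.+ d)
  w*Q≡P : w * Q ≡ P
  w*Q≡P = subst (λ x → x * Q ≡ P) (ℚ.↥p/↧p≡p w) (m/n*n≡m (suc a) (suc d))
  denominator : toℚ E ≡ U * P + Q
  denominator = begin
    toℚ E                        ≡⟨ cong toℚ (ℕ.+-suc (u ℕ.* suc a) d) ⟨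
    toℚ (u ℕ.* suc a ℕ.+ suc d)  ≡⟨ toℚ-+ (u ℕ.* suc a) (suc d) ⟩
    toℚ (u ℕ.* suc a) + Q        ≡⟨ cong (_+ Q) (toℚ-* u (suc a)) ⟩
    U * P + Q                    ∎

rightChild-pos : ∀ v w .{{_ : Positive w}} → Positive (rightChild v w)
rightChild-pos v w = ℚ.pos+nonNeg⇒pos w (toℚ v) {{toℚ-nonNeg v}}

fold-rightChild : ∀ v x k → fold x (rightChild v) k ≡ x + toℚ (k ℕ.* v)
fold-rightChild v x zero    = sym (ℚ.+-identityʳ x)
fold-rightChild v x (suc k) = begin
  fold x (rightChild v) k + toℚ v  ≡⟨ cong (_+ toℚ v) (fold-rightChild v x k) ⟩
  x + toℚ (k ℕ.* v) + toℚ v        ≡⟨ ℚ.+-assoc x _ _ ⟩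
  x + (toℚ (k ℕ.* v) + toℚ v)      ≡⟨ cong (_+_ x) (ℚ.+-comm _ (toℚ v)) ⟩
  x + (toℚ v + toℚ (k ℕ.* v))      ≡⟨ cong (_+_ x) (toℚ-+ v (k ℕ.* v)) ⟨
  x + toℚ (suc k ℕ.* v)            ∎
  where open ≡-Reasoning

fold-leftChild-pos : ∀ u y k .{{_ : Positive y}} → Positive (fold y (leftChild u) k)
fold-leftChild-pos u (mkℚ +[1+ _ ] _ _) zero = _
fold-leftChild-pos u y (suc k) =
  leftChild-pos u (fold y (leftChild u) k) {{fold-leftChild-pos u y k}}

fold-leftChild : ∀ u y k .{{_ : Positive y}} →
                 fold y (leftChild u) k * (toℚ u * toℚ k * y + 1ℚ) ≡ y
fold-leftChild u y zero = solve 2 (λ U y → y :* (U :* con 0ℚ :* y :+ con 1ℚ) := y) refl (toℚ u) y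
fold-leftChild u y (suc k) = begin
  L * (U * toℚ (suc k) * y + 1ℚ)   ≡⟨ cong (λ x → L * (U * x * y + 1ℚ)) (toℚ-+ 1 k) ⟩
  L * (U * (1ℚ + toℚ k) * y + 1ℚ)  ≡⟨ solve 4 (λ L U K y → L :* (U :* (con 1ℚ :+ K) :* y :+ con 1ℚ)
                                                      := L :* (U :* y :+ (U :* K :* y :+ con 1ℚ)))
                                              refl L U (toℚ k) y ⟩
  L * (U * y + C)                  ≡⟨ cong (λ x → L * (U * x + C)) a*C≡y ⟨
  L * (U * (a * C) + C)            ≡⟨ solve 4 (λ L U a C → L :* (U :* (a :* C) :+ C)
                                                      := L :* (U :* a :+ con 1ℚ) :* C) refl L U a C ⟩
  L * (U * a + 1ℚ) * C             ≡⟨ cong (_* C) (leftChild-spec u a {{fold-leftChild-pos u y k}}) ⟩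
  a * C                            ≡⟨ a*C≡y ⟩
  y                                ∎
  where
  open ≡-Reasoning
  U = toℚ u
  a = fold y (leftChild u) k
  L = leftChild u a
  C = U * toℚ k * y + 1ℚ
  a*C≡y : a * C ≡ y
  a*C≡y = fold-leftChild u y k

data Parity : ℕ → Set where
  even : ∀ q → Parity (q ℕ.* 2)
  odd  : ∀ q → Parity (suc (q ℕ.* 2))

parity : ∀ j → Parity j
parity zero = even 0
parity (suc j) with parity j
... | even q = odd q
... | odd q  = even (suc q)

module _ (u v : ℕ) (z : ℚ) where

  vertex0-even : ∀ n q → vertex0 u v z (suc n) (q ℕ.* 2) ≡ leftChild u (vertex0 u v z n q)
  vertex0-even n q rewrite ℕ.m*n%n≡0 q 2 {{ℕ.nonZero}} | ℕ.m*n/n≡m q 2 {{ℕ.nonZero}} = refl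

  vertex0-odd : ∀ n q → vertex0 u v z (suc n) (suc (q ℕ.* 2)) ≡ rightChild v (vertex0 u v z n q)
  vertex0-odd n q rewrite ℕ.[m+kn]%n≡m%n 1 q 2 {{ℕ.nonZero}} =
    cong (λ i → rightChild v (vertex0 u v z n i))
         (trans (ℕ.+-distrib-/-∣ʳ 1 {d = 2} (divides-refl q)) (ℕ.m*n/n≡m q 2))

  vertex0-pos : Positive z → ∀ n j → Positive (vertex0 u v z n j)
  vertex0-pos z>0 zero    j = z>0
  vertex0-pos z>0 (suc n) j with parity j
  ... | even q = subst Positive (sym (vertex0-even n q))
                   (leftChild-pos u (vertex0 u v z n q) {{vertex0-pos z>0 n q}})
  ... | odd q  = subst Positive (sym (vertex0-odd n q))
                   (rightChild-pos v (vertex0 u v z n q) {{vertex0-pos z>0 n q}})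

  -- An even position and its successor are siblings; an odd position 2q+1 and 2q+2
  -- are the right child of position q and the left child of position q+1.
  adjacent-vertices : ∀ n j → suc j < 2 ^ n →
    ∃[ m ] ∃[ q ] ∃[ k ]
      vertex0 u v z n j ≡ fold (leftChild u (vertex0 u v z m q)) (rightChild v) k ×
      vertex0 u v z n (suc j) ≡ fold (rightChild v (vertex0 u v z m q)) (leftChild u) k
  adjacent-vertices zero    j (ℕ.s≤s ())
  adjacent-vertices (suc n) j j+1<2^n+1 with parity j
  ... | even q = n , q , 0 , vertex0-even n q , vertex0-odd n q
  ... | odd q with adjacent-vertices n q
                     (ℕ.*-cancelˡ-< 2 (suc q) (2 ^ n)
                       (subst (_< 2 ^ suc n) (ℕ.*-comm (suc q) 2) j+1<2^n+1))
  ...   | m , p , k , left , right =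
          m , p , suc k , trans (vertex0-odd n q) (cong (rightChild v) left)
                        , trans (vertex0-even n (suc q)) (cong (leftChild u) right)

-- With S = 1 - U t we have S = 1/(U w + 1) and t = w S, so N and D are the
-- numerator w + V and the denominator C of α′ both multiplied by V S.
ancestor-recurrence : ∀ U V K w t α′ f m
  .{{_ : NonNegative U}} .{{_ : Positive V}} .{{_ : NonNegative K}} .{{_ : Positive w}} →
  t * (U * w + 1ℚ) ≡ w → α′ * (U * K * (w + V) + 1ℚ) ≡ w + V → f ≡ t → m ≡ K * V →
  let N = V * f + V * V * (1ℚ - U * f)
      D = U * m * (f + V * (1ℚ - U * f)) + V * (1ℚ - U * f)
  in Σ (NonZero D) (λ nz → α′ ≡ _÷_ N D {{nz}})
ancestor-recurrence U V K w t α′ .t .(K * V) t*W≡w α′*C≡w+V refl refl =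
  ℚ.pos⇒nonZero D {{D-pos}} , *≡⇒≡÷ D {{ℚ.pos⇒nonZero D {{D-pos}}}} α′*D≡N
  where
  open ≡-Reasoning
  W = U * w + 1ℚ
  C = U * K * (w + V) + 1ℚ
  S = 1ℚ - U * t
  N = V * t + V * V * S
  D = U * (K * V) * (t + V * S) + V * S
  instance
    W-pos : Positive W
    W-pos = ℚ.nonNeg+pos⇒pos (U * w) {{ℚ.nonNeg*nonNeg⇒nonNeg U w {{ℚ.pos⇒nonNeg w}}}} 1ℚ
    W≢0 : NonZero W
    W≢0 = ℚ.pos⇒nonZero W
    C-pos : Positive C
    C-pos = ℚ.nonNeg+pos⇒pos (U * K * (w + V))
      {{ℚ.nonNeg*nonNeg⇒nonNeg (U * K) {{ℚ.nonNeg*nonNeg⇒nonNeg U K}} (w + V)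
          {{ℚ.pos⇒nonNeg (w + V) {{ℚ.pos+pos⇒pos w V}}}}}} 1ℚ
  S*W≡1 : S * W ≡ 1ℚ
  S*W≡1 = begin
    S * W            ≡⟨ solve 3 (λ U t W → (con 1ℚ :- U :* t) :* W := W :- U :* (t :* W)) refl U t W ⟩
    W - U * (t * W)  ≡⟨ cong (λ x → W - U * x) t*W≡w ⟩
    W - U * w        ≡⟨ solve 2 (λ U w → U :* w :+ con 1ℚ :- U :* w := con 1ℚ) refl U w ⟩
    1ℚ               ∎
  S≡1/W : S ≡ 1/ W
  S≡1/W = trans (*≡⇒≡÷ W S*W≡1) (ℚ.*-identityˡ (1/ W))
  t≡w*S : t ≡ w * S
  t≡w*S = trans (*≡⇒≡÷ W t*W≡w) (cong (w *_) (sym S≡1/W))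
  D≡VS*C : D ≡ V * S * C
  D≡VS*C = begin
    U * (K * V) * (t + V * S) + V * S      ≡⟨ cong (λ x → U * (K * V) * (x + V * S) + V * S) t≡w*S ⟩
    U * (K * V) * (w * S + V * S) + V * S  ≡⟨ solve 5 (λ U K V w S →
                                                  U :* (K :* V) :* (w :* S :+ V :* S) :+ V :* S
                                                  := V :* S :* (U :* K :* (w :+ V) :+ con 1ℚ))
                                                refl U K V w S ⟩
    V * S * C                              ∎
  N≡VS*[w+V] : N ≡ V * S * (w + V)
  N≡VS*[w+V] = begin
    V * t + V * V * S        ≡⟨ cong (λ x → V * x + V * V * S) t≡w*S ⟩
    V * (w * S) + V * V * S  ≡⟨ solve 3 (λ V w S → V :* (w :* S) :+ V :* V :* S
                                                := V :* S :* (w :+ V)) refl V w S ⟩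
    V * S * (w + V)          ∎
  D-pos : Positive D
  D-pos = subst Positive (sym D≡VS*C)
    (ℚ.pos*pos⇒pos (V * S) {{ℚ.pos*pos⇒pos V S {{subst Positive (sym S≡1/W) (ℚ.1/pos⇒pos W)}}}} C)
  α′*D≡N : α′ * D ≡ N
  α′*D≡N = begin
    α′ * D            ≡⟨ cong (α′ *_) D≡VS*C ⟩
    α′ * (V * S * C)  ≡⟨ solve 4 (λ a V S C → a :* (V :* S :* C) := V :* S :* (a :* C)) refl α′ V S C ⟩
    V * S * (α′ * C)  ≡⟨ cong (V * S *_) α′*C≡w+V ⟩
    V * S * (w + V)   ≡⟨ N≡VS*[w+V] ⟨
    N                 ∎

proposition3p1 : (u v : ℕ) → 1 ≤ u → 1 ≤ v → (z : ℚ) → Positive z →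
    (n i : ℕ) → 1 ≤ i → i < 2 ^ n →
    let α  = c u v z n i
        α' = c u v z n (ℕ.suc i)
        U  = ℤ.+ u ℚ./ 1
        V  = ℤ.+ v ℚ./ 1
        f  = fracPart α
        m  = intPart α
        N  = V * f + V * V * (1ℚ - U * f)
        D  = U * m * (f + V * (1ℚ - U * f)) + V * (1ℚ - U * f)
    in Σ (NonZero D) (λ nz → α' ≡ _÷_ N D {{nz}})
proposition3p1 u@(suc _) v@(suc _) _ _ z z>0 n (suc j) _ j+1<2^n
  with adjacent-vertices u v z n j j+1<2^n
... | m , q , k , α≡ , α′≡ =
  ancestor-recurrence (toℚ u) (toℚ v) (toℚ k) w t α′ (fracPart α) (intPart α)
    {{toℚ-nonNeg u}} {{toℚ-pos v}} {{toℚ-nonNeg k}}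
    (leftChild-spec u w) α′-spec fracPart-α intPart-α
  where
  w  = vertex0 u v z m q
  t  = leftChild u w
  α  = vertex0 u v z n j
  α′ = vertex0 u v z n (suc j)
  instance
    w>0 : Positive w
    w>0 = vertex0-pos u v z z>0 m q
  0≤t : 0ℚ ℚ.≤ t
  0≤t = ℚ.<⇒≤ (ℚ.positive⁻¹ t {{leftChild-pos u w}})
  α≡t+kv : α ≡ t + toℚ (k ℕ.* v)
  α≡t+kv = trans α≡ (fold-rightChild v t k)
  fracPart-α : fracPart α ≡ t
  fracPart-α = trans (cong fracPart α≡t+kv) (fracPart-+toℚ (k ℕ.* v) 0≤t (leftChild<1 u w))
  intPart-α : intPart α ≡ toℚ k * toℚ v
  intPart-α = trans (cong intPart α≡t+kv)
                (trans (intPart-+toℚ (k ℕ.* v) 0≤t (leftChild<1 u w)) (toℚ-* k v))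
  α′-spec : α′ * (toℚ u * toℚ k * (w + toℚ v) + 1ℚ) ≡ w + toℚ v
  α′-spec = subst (λ x → x * (toℚ u * toℚ k * (w + toℚ v) + 1ℚ) ≡ w + toℚ v) (sym α′≡)
              (fold-leftChild u (rightChild v w) k {{rightChild-pos v w}})
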